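{- Let $\alpha\ge 0$ be an integer. If $s\ge \alpha(q+1)-1$ and $k\ge 3$, then \[ m^s(k,q)\le (s+1-\alpha)(q+1)+k-2+\alpha. \] In particular, if $s\ge q$ then $m^s(k,q)\le s(q+1)+k-1$.
   Context: A linear $[n,k,d]_q$ code is identified with a projective system: a finite multiset $\mathcal{G}$ of $n$ points (counted with multiplicity) of $\mathrm{PG}(k-1,q)$, not all lying in one hyperplane, with $n-d=\max_H|\mathcal{G}\cap H|$ over hyperplanes $H$ (counted with multiplicity). The Singleton defect is $n-k+1-d$; the code is A$^s$MDS if its defect is $s$. $m^s(k,q)$ denotes the maximum length $n$ of a non-degenerate $[n,k,d]_q$ A$^s$MDS code. -}

module Defs where

open import Data.Nat using (ℕ; zero; suc; _+_; _∸_; _*_; _≤_; _<_)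
open import Data.Fin using (Fin; zero; suc)
open import Data.Product using (Σ; ∃; _×_; _,_)
open import Relation.Binary.PropositionalEquality using (_≡_; _≢_)
open import Relation.Binary.Definitions using (DecidableEquality)
open import Relation.Nullary using (yes; no)
open import Algebra.Structures using (IsCommutativeRing)
open import Function.Bundles using (_⤖_)

record FiniteField (q : ℕ) : Set₁ where
  field
    Carrier : Set
    _+F_ _*F_ : Carrier → Carrier → Carrier
    -F_ : Carrier → Carrier
    0F 1F : Carrier
    isCommutativeRing : IsCommutativeRing _≡_ _+F_ _*F_ -F_ 0F 1F
    0≢1 : 0F ≢ 1F
    inverse : ∀ x → x ≢ 0F → Σ Carrier (λ y → x *F y ≡ 1F)
    _≟F_ : DecidableEquality Carrier
    enumeration : Fin q ⤖ Carrier

module _ {q : ℕ} (F : FiniteField q) where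
  open FiniteField F

  Vec : ℕ → Set
  Vec k = Fin k → Carrier

  NonZeroVec : ∀ {k} → Vec k → Set
  NonZeroVec {k} u = ∃ λ (i : Fin k) → u i ≢ 0F

  dot : ∀ {k} → Vec k → Vec k → Carrier
  dot {zero}  u x = 0F
  dot {suc k} u x = (u zero *F x zero) +F dot (λ i → u (suc i)) (λ i → x (suc i))

  hypCount : ∀ {k n} → Vec k → (Fin n → Vec k) → ℕ
  hypCount {n = zero}  u G = 0
  hypCount {n = suc n} u G with dot u (G zero) ≟F 0F
  ... | yes _ = suc (hypCount u (λ j → G (suc j)))
  ... | no  _ = hypCount u (λ j → G (suc j))

  -- A multiset of n points of PG(k-1,q), given by nonzero representatives,
  -- not all lying in one hyperplane.
  IsProjectiveSystem : ∀ {k n} → (Fin n → Vec k) → Set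
  IsProjectiveSystem {k} {n} G =
    (∀ j → NonZeroVec (G j)) ×
    (∀ (u : Vec k) → NonZeroVec u → hypCount u G < n)

  IsMaxHyperplaneCount : ∀ {k n} → (Fin n → Vec k) → ℕ → Set
  IsMaxHyperplaneCount {k} G m =
    (∃ λ (u : Vec k) → NonZeroVec u × hypCount u G ≡ m) ×
    (∀ (u : Vec k) → NonZeroVec u → hypCount u G ≤ m)

  -- G is a projective system of a [n,k,d]_q code with Singleton defect s:
  -- d = n - max_H |G ∩ H| and n - k + 1 - d = s.
  IsAsMDS : (s k n : ℕ) → (Fin n → Vec k) → Set
  IsAsMDS s k n G =
    IsProjectiveSystem G ×
    ∃ λ m → IsMaxHyperplaneCount G m × (m ≤ n) × (n + 1 ≡ k + (n ∸ m) + s)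

{-# OPTIONS --safe #-}
-- Let m = k - 1 + s be the largest number of points of G on a hyperplane, attained by h.
-- Any k - 3 points of G on h lie, together with a point y off h, in a codimension-2
-- subspace A. The q + 1 hyperplanes through A cover the points of G on h, those in A
-- q + 1 times and the others once, so when α (q + 1) ≤ s + 1 one of them, w, meets h in
-- more than k - 3 + α points (and w ≠ h since y ∈ w). The q + 1 hyperplanes through
-- h ∩ w cover all n points, those of h ∩ w q + 1 times, and each carries at most m of
-- them: n + q |h ∩ w| ≤ (q + 1) m, which rearranges to the bound. α = 1 gives the
-- second claim.
module Submission where

open import Defs
open import Data.Nat using (ℕ; _+_; _∸_; _*_; _≤_)
open import Data.Fin using (Fin)
open import Data.Product using (_×_)

open import Algebra.Bundles using (CommutativeRing)
import Algebra.Properties.AbelianGroup as AbelianGroupProperties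
import Algebra.Properties.Ring as RingProperties
import Algebra.Properties.Semiring.Sum as SemiringSum
open import Data.Bool.Base using (if_then_else_)
import Data.Fin.Properties as Fin
open import Data.List using (List; []; _∷_; length; map; tabulate)
open import Data.List.Properties using (length-map; length-tabulate)
import Data.List.Relation.Binary.Permutation.Propositional as ↭
open import Data.List.Relation.Binary.Permutation.Propositional using (_↭_; ↭-sym)
open import Data.List.Relation.Binary.Permutation.Propositional.Properties using (All-resp-↭; ↭-length)
open import Data.List.Relation.Binary.Sublist.Propositional using (_⊆_; []; _∷_; _∷ʳ_; minimum)
open import Data.List.Relation.Unary.All as All using (All; []; _∷_)
open import Data.List.Relation.Unary.All.Properties using (++⁺; map⁻)
open import Data.Nat using (zero; suc; z≤n; s≤s; _<_; _≤?_)
import Data.Nat.ListAction as List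
import Data.Nat.Properties as ℕ
open import Data.Nat.Tactic.RingSolver using (solve-∀)
open import Data.Product using (∃; ∃₂; _,_; proj₁; proj₂; map₂; uncurry)
open import Data.Sum using (_⊎_; inj₁; inj₂)
import Data.Vec.Functional as Vector
open import Function.Base using (_∘_)
open import Function.Bundles using (_⇔_; mk⇔; Equivalence; Bijection; _⤖_)
open import Relation.Binary.Definitions using (DecidableEquality)
open import Relation.Binary.PropositionalEquality
open import Relation.Nullary using (Dec; does; yes; no; ¬_; contradiction)
open import Relation.Nullary.Decidable using (dec-true; does-⇔)

open SemiringSum ℕ.+-*-semiring
  using (sum-syntax; sum-cong-≗; sum-replicate-zero; ∑-distrib-+; *-distribʳ-sum)
open import Algebra.Properties.CommutativeSemigroup ℕ.*-commutativeSemigroup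
  using (x∙yz≈y∙xz)

singletonDefect⇒maxCount : ∀ {n m t s} → m ≤ n → n + 1 ≡ 3 + t + (n ∸ m) + s → m ≡ 2 + t + s
singletonDefect⇒maxCount {n} {m} {t} {s} m≤n defect =
  ℕ.+-cancelˡ-≡ (n ∸ m) m (2 + t + s) (ℕ.suc-injective (begin
    suc (n ∸ m + m)             ≡⟨ ℕ.+-comm 1 _ ⟩
    n ∸ m + m + 1               ≡⟨ cong (_+ 1) (ℕ.m∸n+n≡m m≤n) ⟩
    n + 1                       ≡⟨ defect ⟩
    3 + t + (n ∸ m) + s         ≡⟨ regroup t (n ∸ m) s ⟩
    suc (n ∸ m + (2 + t + s))   ∎))
  where
    open ≡-Reasoning
    regroup : ∀ t d s → 3 + t + d + s ≡ suc (d + (2 + t + s))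
    regroup = solve-∀

[1+q][t+α]<[2+t+s]+q*t : ∀ {α q s} t → α * (q + 1) ≤ s + 1 → suc q * (t + α) < (2 + t + s) + q * t
[1+q][t+α]<[2+t+s]+q*t {α} {q} {s} t α[q+1]≤s+1 = begin
  suc (suc q * (t + α))            ≡⟨ expand q t α ⟩
  suc (t + q * t + α * (q + 1))    ≤⟨ ℕ.+-monoʳ-≤ (suc (t + q * t)) α[q+1]≤s+1 ⟩
  suc (t + q * t + (s + 1))        ≡⟨ regroup q t s ⟩
  (2 + t + s) + q * t              ∎
  where
    open ℕ.≤-Reasoning
    expand : ∀ q t α → suc (suc q * (t + α)) ≡ suc (t + q * t + α * (q + 1))
    expand = solve-∀
    regroup : ∀ q t s → suc (t + q * t + (s + 1)) ≡ (2 + t + s) + q * t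
    regroup = solve-∀


n+q[1+t+α]≤[1+q][2+t+s]⇒n≤bound : ∀ {α q s t} n → α * (q + 1) ≤ s + 1 →
  n + q * suc (t + α) ≤ suc q * (2 + t + s) → n ≤ (s + 1 ∸ α) * (q + 1) + suc t + α
n+q[1+t+α]≤[1+q][2+t+s]⇒n≤bound {α} {q} {s} {t} n α[q+1]≤s+1 n+q[1+t+α]≤ =
  ℕ.+-cancelʳ-≤ (q * suc (t + α)) n _ (ℕ.≤-trans n+q[1+t+α]≤ (ℕ.≤-reflexive (begin
    suc q * (2 + t + s)                         ≡⟨ regroup q t s ⟩
    suc q * (suc t + (s + 1))                   ≡⟨ cong (λ z → suc q * (suc t + z)) (sym r+α≡s+1) ⟩
    suc q * (suc t + (r + α))                   ≡⟨ expand r q t α ⟩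
    r * (q + 1) + suc t + α + q * suc (t + α)   ∎)))
  where
    open ≡-Reasoning
    r = s + 1 ∸ α
    α≤s+1 : α ≤ s + 1
    α≤s+1 = ℕ.≤-trans (subst (λ z → α ≤ α * z) (ℕ.+-comm 1 q) (ℕ.m≤m*n α (suc q))) α[q+1]≤s+1
    r+α≡s+1 : r + α ≡ s + 1
    r+α≡s+1 = ℕ.m∸n+n≡m α≤s+1
    regroup : ∀ q t s → suc q * (2 + t + s) ≡ suc q * (suc t + (s + 1))
    regroup = solve-∀
    expand : ∀ r q t α → suc q * (suc t + (r + α)) ≡ r * (q + 1) + suc t + α + q * suc (t + α)
    expand = solve-∀

-- Opened only after the arithmetic above: with Fin's constructors in scope, solve-∀
-- fails on goals containing suc.
open import Data.Fin using (zero; suc)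

𝟙 : ∀ {p} {P : Set p} → Dec P → ℕ
𝟙 P? = if does P? then 1 else 0

𝟙-cong : ∀ {p r} {P : Set p} {R : Set r} → P ⇔ R → (P? : Dec P) (R? : Dec R) → 𝟙 P? ≡ 𝟙 R?
𝟙-cong P⇔R P? R? = cong (λ b → if b then 1 else 0) (does-⇔ P⇔R P? R?)

𝟙-yes : ∀ {p} {P : Set p} → P → (P? : Dec P) → 𝟙 P? ≡ 1
𝟙-yes p P? = cong (λ b → if b then 1 else 0) (dec-true P? p)

∑-mono-≤ : ∀ {n} {f g : Fin n → ℕ} → (∀ i → f i ≤ g i) → ∑[ i < n ] f i ≤ ∑[ i < n ] g i
∑-mono-≤ {zero}  f≤g = z≤n
∑-mono-≤ {suc n} f≤g = ℕ.+-mono-≤ (f≤g zero) (∑-mono-≤ (f≤g ∘ suc))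

∑-const : ∀ n c → ∑[ i < n ] c ≡ n * c
∑-const zero    c = refl
∑-const (suc n) c = cong (c +_) (∑-const n c)

pigeonhole : ∀ {n} (f : Fin n → ℕ) B → n * B < ∑[ i < n ] f i → ∃ λ i → B < f i
pigeonhole {n} f B n*B<∑f =
  map₂ ℕ.≰⇒> (Fin.¬∀⟶∃¬ n (λ i → f i ≤ B) (λ i → f i ≤? B) λ f≤B →
    ℕ.<⇒≱ n*B<∑f (ℕ.≤-trans (∑-mono-≤ f≤B) (ℕ.≤-reflexive (∑-const n B))))

∑-𝟙-≟ : ∀ {n} (j : Fin n) → ∑[ i < n ] 𝟙 (i Fin.≟ j) ≡ 1
∑-𝟙-≟ {suc n} zero    = cong suc (sum-replicate-zero n)
∑-𝟙-≟         (suc j) = ∑-𝟙-≟ j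

∑-𝟙-bijection : ∀ {a n} {A : Set a} (e : Fin n ⤖ A) (_≟_ : DecidableEquality A) c →
                ∑[ i < n ] 𝟙 (Bijection.to e i ≟ c) ≡ 1
∑-𝟙-bijection {n = n} e _≟_ c =
  trans (sum-cong-≗ {n} λ i → 𝟙-cong (e[i]≡c⇔i≡j i) (Bijection.to e i ≟ c) (i Fin.≟ j)) (∑-𝟙-≟ j)
  where
    j = proj₁ (Bijection.surjective e c)
    e[i]≡c⇔i≡j : ∀ i → Bijection.to e i ≡ c ⇔ i ≡ j
    e[i]≡c⇔i≡j i = mk⇔
      (λ e[i]≡c → Bijection.injective e (trans e[i]≡c (sym (proj₂ (Bijection.surjective e c) refl))))
      (proj₂ (Bijection.surjective e c))

module _ {q : ℕ} (F : FiniteField q) where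
  open FiniteField F

  commutativeRing : CommutativeRing _ _
  commutativeRing = record { isCommutativeRing = isCommutativeRing }

  open CommutativeRing commutativeRing
    using ( +-comm; +-identityˡ; +-identityʳ; -‿inverseʳ; *-comm; *-assoc; *-identityʳ
          ; zeroˡ; zeroʳ; distribʳ; ring; +-abelianGroup; semiring )
  open RingProperties ring using (-‿distribˡ-*)
  open AbelianGroupProperties +-abelianGroup using (inverseʳ-unique)
  module FieldSum = SemiringSum semiring

  affine-root : ∀ {a b b⁻¹ x} → b *F b⁻¹ ≡ 1F → (a +F (x *F b) ≡ 0F) ⇔ (x ≡ -F (a *F b⁻¹))
  affine-root {a} {b} {b⁻¹} {x} bb⁻¹≡1 = mk⇔ root⇒ ⇒root
    where
      open ≡-Reasoning
      root⇒ : a +F (x *F b) ≡ 0F → x ≡ -F (a *F b⁻¹)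
      root⇒ root = begin
        x                  ≡⟨ sym (*-identityʳ x) ⟩
        x *F 1F            ≡⟨ cong (x *F_) (sym bb⁻¹≡1) ⟩
        x *F (b *F b⁻¹)    ≡⟨ sym (*-assoc x b b⁻¹) ⟩
        (x *F b) *F b⁻¹    ≡⟨ cong (_*F b⁻¹) (inverseʳ-unique a (x *F b) root) ⟩
        (-F a) *F b⁻¹      ≡⟨ sym (-‿distribˡ-* a b⁻¹) ⟩
        -F (a *F b⁻¹)      ∎
      ⇒root : x ≡ -F (a *F b⁻¹) → a +F (x *F b) ≡ 0F
      ⇒root refl = begin
        a +F ((-F (a *F b⁻¹)) *F b)  ≡⟨ cong (a +F_) (sym (-‿distribˡ-* (a *F b⁻¹) b)) ⟩
        a +F (-F ((a *F b⁻¹) *F b))  ≡⟨ cong (λ z → a +F (-F z)) (*-assoc a b⁻¹ b) ⟩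
        a +F (-F (a *F (b⁻¹ *F b)))  ≡⟨ cong (λ z → a +F (-F (a *F z))) (trans (*-comm b⁻¹ b) bb⁻¹≡1) ⟩
        a +F (-F (a *F 1F))          ≡⟨ cong (λ z → a +F (-F z)) (*-identityʳ a) ⟩
        a +F (-F a)                  ≡⟨ -‿inverseʳ a ⟩
        0F                           ∎

  x+y*0≡x : ∀ a c → a +F (c *F 0F) ≡ a
  x+y*0≡x a c = trans (cong (a +F_) (zeroʳ c)) (+-identityʳ a)

  e : Fin q → Carrier
  e = Bijection.to enumeration

  ∑-𝟙-affine : ∀ a b → 𝟙 (b ≟F 0F) + ∑[ i < q ] 𝟙 ((a +F (e i *F b)) ≟F 0F)
                      ≡ 1 + q * (𝟙 (a ≟F 0F) * 𝟙 (b ≟F 0F))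
  ∑-𝟙-affine a b with b ≟F 0F
  ... | yes refl = cong suc (begin
    ∑[ i < q ] 𝟙 ((a +F (e i *F 0F)) ≟F 0F)
      ≡⟨ sum-cong-≗ {q} (λ i → cong (λ z → 𝟙 (z ≟F 0F)) (x+y*0≡x a (e i))) ⟩
    ∑[ i < q ] 𝟙 (a ≟F 0F)  ≡⟨ ∑-const q _ ⟩
    q * 𝟙 (a ≟F 0F)         ≡⟨ cong (q *_) (sym (ℕ.*-identityʳ _)) ⟩
    q * (𝟙 (a ≟F 0F) * 1)   ∎)
    where open ≡-Reasoning
  ... | no b≢0 = begin
    ∑[ i < q ] 𝟙 ((a +F (e i *F b)) ≟F 0F)
      ≡⟨ sum-cong-≗ {q} (λ i → 𝟙-cong (affine-root bb⁻¹≡1) ((a +F (e i *F b)) ≟F 0F) (e i ≟F _)) ⟩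
    ∑[ i < q ] 𝟙 (e i ≟F (-F (a *F b⁻¹)))
      ≡⟨ ∑-𝟙-bijection enumeration _≟F_ _ ⟩
    1
      ≡⟨ cong suc (sym (trans (cong (q *_) (ℕ.*-zeroʳ (𝟙 (a ≟F 0F)))) (ℕ.*-zeroʳ q))) ⟩
    1 + q * (𝟙 (a ≟F 0F) * 0)
      ∎
    where
      open ≡-Reasoning
      b⁻¹ = proj₁ (inverse b b≢0)
      bb⁻¹≡1 = proj₂ (inverse b b≢0)

  infix 25 _·_
  _·_ : ∀ {k} → Vec F k → Vec F k → Carrier
  _·_ = dot F

  infix 4 _⊥_
  _⊥_ : ∀ {k} → Vec F k → Vec F k → Set
  u ⊥ x = u · x ≡ 0F

  _+[_]_ : ∀ {k} → Vec F k → Carrier → Vec F k → Vec F k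
  (u +[ c ] v) i = u i +F (c *F v i)

  dot≡∑ : ∀ {k} (u x : Vec F k) → u · x ≡ FieldSum.sum (λ i → u i *F x i)
  dot≡∑ {zero}  u x = refl
  dot≡∑ {suc k} u x = cong ((u zero *F x zero) +F_) (dot≡∑ (Vector.tail u) (Vector.tail x))

  ·-comm : ∀ {k} (u x : Vec F k) → u · x ≡ x · u
  ·-comm u x =
    trans (dot≡∑ u x) (trans (FieldSum.sum-cong-≗ (λ i → *-comm (u i) (x i))) (sym (dot≡∑ x u)))

  ·-linearˡ : ∀ {k} (u v x : Vec F k) c → (u +[ c ] v) · x ≡ (u · x) +F (c *F (v · x))
  ·-linearˡ {k} u v x c = begin
    (u +[ c ] v) · x
      ≡⟨ dot≡∑ (u +[ c ] v) x ⟩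
    ∑ (λ i → (u i +F (c *F v i)) *F x i)
      ≡⟨ FieldSum.sum-cong-≗ {k} distrib ⟩
    ∑ (λ i → (u i *F x i) +F (c *F (v i *F x i)))
      ≡⟨ FieldSum.∑-distrib-+ (λ i → u i *F x i) _ ⟩
    ∑ (λ i → u i *F x i) +F ∑ (λ i → c *F (v i *F x i))
      ≡⟨ cong₂ _+F_ (sym (dot≡∑ u x)) (sym (FieldSum.*-distribˡ-sum c (λ i → v i *F x i))) ⟩
    (u · x) +F (c *F ∑ (λ i → v i *F x i))
      ≡⟨ cong (λ z → (u · x) +F (c *F z)) (sym (dot≡∑ v x)) ⟩
    (u · x) +F (c *F (v · x))
      ∎
    where
      open ≡-Reasoning
      ∑ = FieldSum.sum
      distrib : ∀ i → (u i +F (c *F v i)) *F x i ≡ (u i *F x i) +F (c *F (v i *F x i))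
      distrib i = trans (distribʳ (x i) (u i) (c *F v i)) (cong ((u i *F x i) +F_) (*-assoc c (v i) (x i)))

  ·-linearˡ-⊥ : ∀ {k} (u v x : Vec F k) c → v ⊥ x → (u +[ c ] v) · x ≡ u · x
  ·-linearˡ-⊥ u v x c v⊥x =
    trans (·-linearˡ u v x c) (trans (cong (λ z → (u · x) +F (c *F z)) v⊥x) (x+y*0≡x (u · x) c))

  ·-linearʳ-⊥ : ∀ {k} (u x y : Vec F k) c → u ⊥ y → u · (x +[ c ] y) ≡ u · x
  ·-linearʳ-⊥ u x y c u⊥y =
    trans (·-comm u (x +[ c ] y)) (trans (·-linearˡ-⊥ x y u c (trans (·-comm y u) u⊥y)) (·-comm x u))

  ·-zeroˡ : ∀ {k} {u : Vec F k} x → (∀ i → u i ≡ 0F) → u · x ≡ 0F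
  ·-zeroˡ {k} {u} x u≡0 = trans (dot≡∑ u x)
    (trans (FieldSum.sum-cong-≗ {k} (λ i → trans (cong (_*F x i) (u≡0 i)) (zeroˡ (x i))))
           (FieldSum.sum-replicate-zero k))

  non-orthogonal⇒nonzero : ∀ {k} {u x : Vec F k} → u · x ≢ 0F → NonZeroVec F u
  non-orthogonal⇒nonzero {k} {u} {x} u·x≢0 =
    Fin.¬∀⟶∃¬ k (λ i → u i ≡ 0F) (λ i → u i ≟F 0F) (u·x≢0 ∘ ·-zeroˡ x)

  unit : ∀ {k} → Fin k → Vec F k
  unit zero    zero    = 1F
  unit zero    (suc _) = 0F
  unit (suc _) zero    = 0F
  unit (suc i) (suc j) = unit i j

  ·-unitʳ : ∀ {k} (u : Vec F k) i → u · unit i ≡ u i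
  ·-unitʳ u zero = trans (cong₂ _+F_ (*-identityʳ (u zero)) tail·0≡0) (+-identityʳ (u zero))
    where
      tail·0≡0 : Vector.tail u · (λ _ → 0F) ≡ 0F
      tail·0≡0 = trans (·-comm (Vector.tail u) _) (·-zeroˡ (Vector.tail u) (λ _ → refl))
  ·-unitʳ u (suc i) =
    trans (cong₂ _+F_ (zeroʳ (u zero)) (·-unitʳ (Vector.tail u) i)) (+-identityˡ (u (suc i)))

  nonzero⇒non-orthogonal : ∀ {k} (u : Vec F k) → NonZeroVec F u → ∃ λ y → u · y ≢ 0F
  nonzero⇒non-orthogonal u (i , uᵢ≢0) =
    unit i , λ u·eᵢ≡0 → uᵢ≢0 (trans (sym (·-unitʳ u i)) u·eᵢ≡0)

  pivot : ∀ {k} (Ps : List (Vec F (suc k))) →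
          All (λ P → P zero ≡ 0F) Ps ⊎ ∃₂ λ P rest → P zero ≢ 0F × Ps ↭ P ∷ rest
  pivot [] = inj₁ []
  pivot (Q ∷ Qs) with Q zero ≟F 0F | pivot Qs
  ... | no Q₀≢0  | _                             = inj₂ (Q , Qs , Q₀≢0 , ↭.refl)
  ... | yes Q₀≡0 | inj₁ Qs₀≡0                    = inj₁ (Q₀≡0 ∷ Qs₀≡0)
  ... | yes _    | inj₂ (P , rest , P₀≢0 , Qs↭) =
    inj₂ (P , Q ∷ rest , P₀≢0 , ↭.trans (↭.prep Q Qs↭) (↭.swap Q P ↭.refl))

  fewer-equations⇒nonzero-solution : ∀ {k} (Ps : List (Vec F k)) → length Ps < k →
                                     ∃ λ u → NonZeroVec F u × All (u ⊥_) Ps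
  fewer-equations⇒nonzero-solution {suc k} Ps |Ps|≤k with pivot Ps
  ... | inj₁ Ps₀≡0 = unit zero , (zero , 0≢1 ∘ sym) , All.map (λ {Q} → unit₀⊥ {Q}) Ps₀≡0
    where
      unit₀⊥ : ∀ {P : Vec F (suc k)} → P zero ≡ 0F → unit zero ⊥ P
      unit₀⊥ {P} P₀≡0 = trans (·-comm (unit zero) P) (trans (·-unitʳ P zero) P₀≡0)
  ... | inj₂ (P , rest , P₀≢0 , Ps↭) =
    u , (suc (proj₁ v≢0) , proj₂ v≢0) ,
    All-resp-↭ (↭-sym Ps↭) (u⊥P ∷ All.map (λ {Q} → u⊥ {Q}) (map⁻ v⊥))
    where
      open ≡-Reasoning
      P₀⁻¹ = proj₁ (inverse (P zero) P₀≢0)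
      P₀P₀⁻¹≡1 = proj₂ (inverse (P zero) P₀≢0)
      eliminate : Vec F (suc k) → Vec F (suc k)
      eliminate Q = Q +[ -F (Q zero *F P₀⁻¹) ] P
      eliminate₀ : ∀ Q → eliminate Q zero ≡ 0F
      eliminate₀ Q = Equivalence.from (affine-root P₀P₀⁻¹≡1) refl
      reduced = map (Vector.tail ∘ eliminate) rest
      |reduced|<k : length reduced < k
      |reduced|<k = subst (_< k) (sym (length-map _ rest))
                      (ℕ.≤-pred (subst (λ l → suc l ≤ suc k) (↭-length Ps↭) |Ps|≤k))
      solution = fewer-equations⇒nonzero-solution reduced |reduced|<k
      v = proj₁ solution
      v≢0 = proj₁ (proj₂ solution)
      v⊥ = proj₂ (proj₂ solution)
      u : Vec F (suc k)
      u = (-F ((v · Vector.tail P) *F P₀⁻¹)) Vector.∷ v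
      u⊥P : u ⊥ P
      u⊥P = trans (+-comm _ _) (Equivalence.from (affine-root P₀P₀⁻¹≡1) refl)
      u⊥ : ∀ {Q} → v ⊥ Vector.tail (eliminate Q) → u ⊥ Q
      u⊥ {Q} v⊥Q = begin
        u · Q                                                 ≡⟨ sym (·-linearʳ-⊥ u Q P _ u⊥P) ⟩
        (u zero *F eliminate Q zero) +F (v · Vector.tail (eliminate Q))
          ≡⟨ cong₂ _+F_ (trans (cong (u zero *F_) (eliminate₀ Q)) (zeroʳ (u zero))) v⊥Q ⟩
        0F +F 0F                                              ≡⟨ +-identityʳ 0F ⟩
        0F                                                    ∎

  pencil : ∀ {k} → Vec F k → Vec F k → Fin (suc q) → Vec F k
  pencil u v zero    = v
  pencil u v (suc i) = u +[ e i ] v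

  pencil-nonzero : ∀ {k} (u v x : Vec F k) → u · x ≢ 0F → v ⊥ x → NonZeroVec F v →
                   ∀ i → NonZeroVec F (pencil u v i)
  pencil-nonzero u v x u·x≢0 v⊥x v≢0 zero    = v≢0
  pencil-nonzero u v x u·x≢0 v⊥x v≢0 (suc i) =
    non-orthogonal⇒nonzero {x = x} (u·x≢0 ∘ trans (sym (·-linearˡ-⊥ u v x (e i) v⊥x)))

  OnAll : ∀ {k} → List (Vec F k) → Vec F k → Set
  OnAll us x = All (_⊥ x) us

  pencil-⊥ : ∀ {k} {u v x : Vec F k} → OnAll (u ∷ v ∷ []) x → ∀ i → pencil u v i ⊥ x
  pencil-⊥                 (u⊥x ∷ v⊥x ∷ []) zero    = v⊥x
  pencil-⊥ {u = u} {v} {x} (u⊥x ∷ v⊥x ∷ []) (suc i) = trans (·-linearˡ-⊥ u v x (e i) v⊥x) u⊥x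

  on : ∀ {k} → Vec F k → Vec F k → ℕ
  on u x = 𝟙 (u · x ≟F 0F)

  onAll : ∀ {k} → List (Vec F k) → Vec F k → ℕ
  onAll us x = List.product (map (λ u → on u x) us)

  countOn : ∀ {k} → List (Vec F k) → List (Vec F k) → ℕ
  countOn us xs = List.sum (map (onAll us) xs)

  onAll-yes : ∀ {k} {us : List (Vec F k)} {x} → OnAll us x → onAll us x ≡ 1
  onAll-yes []               = refl
  onAll-yes {us = u ∷ _} {x} (u⊥x ∷ x∈us) = cong₂ _*_ (𝟙-yes u⊥x (u · x ≟F 0F)) (onAll-yes x∈us)

  onAll-no : ∀ {k} (us : List (Vec F k)) {x} → ¬ OnAll us x → onAll us x ≡ 0
  onAll-no []       x∉[] = contradiction [] x∉[]
  onAll-no (u ∷ us) {x} x∉u∷us with u · x ≟F 0F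
  ... | yes u⊥x = trans (ℕ.+-identityʳ (onAll us x)) (onAll-no us (x∉u∷us ∘ (u⊥x ∷_)))
  ... | no  _   = refl

  countOn-[] : ∀ {k} (xs : List (Vec F k)) → countOn [] xs ≡ length xs
  countOn-[] []       = refl
  countOn-[] (x ∷ xs) = cong suc (countOn-[] xs)

  countOn-swap : ∀ {k} (u v : Vec F k) us xs → countOn (u ∷ v ∷ us) xs ≡ countOn (v ∷ u ∷ us) xs
  countOn-swap u v us []       = refl
  countOn-swap u v us (x ∷ xs) =
    cong₂ _+_ (x∙yz≈y∙xz (on u x) (on v x) (onAll us x)) (countOn-swap u v us xs)

  hypCount≡countOn : ∀ {k n} (u : Vec F k) (G : Fin n → Vec F k) →
                     hypCount F u G ≡ countOn (u ∷ []) (tabulate G)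
  hypCount≡countOn {n = zero}  u G = refl
  hypCount≡countOn {n = suc n} u G with u · G zero ≟F 0F
  ... | yes _ = cong suc (hypCount≡countOn u (G ∘ suc))
  ... | no  _ = hypCount≡countOn u (G ∘ suc)

  -- A point on u and v lies on all q + 1 members of the pencil, any other point on exactly one.
  ∑-on-pencil : ∀ {k} (u v x : Vec F k) → ∑[ i < suc q ] on (pencil u v i) x ≡ 1 + q * (on u x * on v x)
  ∑-on-pencil u v x = trans
    (cong (on v x +_) (sum-cong-≗ {q} λ i → cong (λ z → 𝟙 (z ≟F 0F)) (·-linearˡ u v x (e i))))
    (∑-𝟙-affine (u · x) (v · x))

  ∑-onAll-pencil : ∀ {k} (u v : Vec F k) us x →
                   ∑[ i < suc q ] onAll (pencil u v i ∷ us) x ≡ onAll us x + q * onAll (u ∷ v ∷ us) x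
  ∑-onAll-pencil u v us x = begin
    ∑[ i < suc q ] (on (pencil u v i) x * onAll us x)
      ≡⟨ sym (*-distribʳ-sum (onAll us x) (λ i → on (pencil u v i) x)) ⟩
    (∑[ i < suc q ] on (pencil u v i) x) * onAll us x
      ≡⟨ cong (_* onAll us x) (∑-on-pencil u v x) ⟩
    (1 + q * (on u x * on v x)) * onAll us x
      ≡⟨ expand q (on u x) (on v x) (onAll us x) ⟩
    onAll us x + q * (on u x * (on v x * onAll us x))
      ∎
    where
      open ≡-Reasoning
      expand : ∀ q a b c → (1 + q * (a * b)) * c ≡ c + q * (a * (b * c))
      expand = solve-∀

  ∑-countOn-pencil : ∀ {k} (u v : Vec F k) us xs →
                     ∑[ i < suc q ] countOn (pencil u v i ∷ us) xs
                       ≡ countOn us xs + q * countOn (u ∷ v ∷ us) xs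
  ∑-countOn-pencil u v us []       = trans (sum-replicate-zero (suc q)) (sym (ℕ.*-zeroʳ q))
  ∑-countOn-pencil u v us (x ∷ xs) = begin
    ∑[ i < suc q ] (onAll (pencil u v i ∷ us) x + countOn (pencil u v i ∷ us) xs)
      ≡⟨ ∑-distrib-+ (λ i → onAll (pencil u v i ∷ us) x) (λ i → countOn (pencil u v i ∷ us) xs) ⟩
    ∑[ i < suc q ] onAll (pencil u v i ∷ us) x + ∑[ i < suc q ] countOn (pencil u v i ∷ us) xs
      ≡⟨ cong₂ _+_ (∑-onAll-pencil u v us x) (∑-countOn-pencil u v us xs) ⟩
    (onAll us x + q * onAll (u ∷ v ∷ us) x) + (countOn us xs + q * countOn (u ∷ v ∷ us) xs)
      ≡⟨ regroup q (onAll us x) (onAll (u ∷ v ∷ us) x) (countOn us xs) (countOn (u ∷ v ∷ us) xs) ⟩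
    countOn us (x ∷ xs) + q * countOn (u ∷ v ∷ us) (x ∷ xs) ∎
    where
      open ≡-Reasoning
      regroup : ∀ q a b c d → (a + q * b) + (c + q * d) ≡ (a + c) + q * (b + d)
      regroup = solve-∀

  select : ∀ {k} (us xs : List (Vec F k)) t → t ≤ countOn us xs →
           ∃ λ Ps → Ps ⊆ xs × length Ps ≡ t × All (OnAll us) Ps
  select us xs       zero    _ = [] , minimum xs , refl , []
  select us (x ∷ xs) (suc t) t<count with All.all? (λ u → u · x ≟F 0F) us
  ... | yes x∈us =
    let Ps , Ps⊆xs , |Ps|≡t , Ps∈us = select us xs t
          (ℕ.≤-pred (subst (λ c → suc t ≤ c + countOn us xs) (onAll-yes x∈us) t<count))
    in x ∷ Ps , refl ∷ Ps⊆xs , cong suc |Ps|≡t , x∈us ∷ Ps∈us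
  ... | no x∉us =
    let Ps , Ps⊆xs , |Ps|≡t , Ps∈us = select us xs (suc t)
          (subst (λ c → suc t ≤ c + countOn us xs) (onAll-no us x∉us) t<count)
    in Ps , x ∷ʳ Ps⊆xs , |Ps|≡t , Ps∈us

  length≤countOn : ∀ {k} {us Ps xs : List (Vec F k)} → Ps ⊆ xs → All (OnAll us) Ps →
                   length Ps ≤ countOn us xs
  length≤countOn []             []             = z≤n
  length≤countOn {us = us} (x ∷ʳ Ps⊆xs) Ps∈us =
    ℕ.≤-trans (length≤countOn Ps⊆xs Ps∈us) (ℕ.m≤n+m _ (onAll us x))
  length≤countOn (refl ∷ Ps⊆xs) (x∈us ∷ Ps∈us) =
    ℕ.+-mono-≤ (ℕ.≤-reflexive (sym (onAll-yes x∈us))) (length≤countOn Ps⊆xs Ps∈us)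

  ∃-pencil-through : ∀ {k} (Ps : List (Vec F k)) → 2 + length Ps ≤ k →
                     ∃₂ λ a b → All (OnAll (a ∷ b ∷ [])) Ps × (∀ i → NonZeroVec F (pencil a b i))
  ∃-pencil-through Ps 2+|Ps|≤k =
    let a , a≢0 , a⊥Ps = fewer-equations⇒nonzero-solution Ps (ℕ.≤-trans (ℕ.n≤1+n _) 2+|Ps|≤k)
        z , a·z≢0 = nonzero⇒non-orthogonal a a≢0
        b , b≢0 , b⊥z∷Ps = fewer-equations⇒nonzero-solution (z ∷ Ps) 2+|Ps|≤k
    in a , b , All.zipWith (λ (a⊥P , b⊥P) → a⊥P ∷ b⊥P ∷ []) (a⊥Ps , All.tail b⊥z∷Ps) ,
       pencil-nonzero a b z a·z≢0 (All.head b⊥z∷Ps) b≢0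

  ∃-rich-section : ∀ {k t} (xs : List (Vec F k)) (h y : Vec F k) →
                   3 + t ≤ k → t ≤ countOn (h ∷ []) xs →
                   ∀ B → suc q * B < countOn (h ∷ []) xs + q * t →
                   ∃ λ w → NonZeroVec F w × w ⊥ y × B < countOn (h ∷ w ∷ []) xs
  ∃-rich-section {t = t} xs h y 3+t≤k t≤|h| B [1+q]B<|h|+qt =
    let Ps , Ps⊆xs , |Ps|≡t , Ps⊆h = select (h ∷ []) xs t t≤|h|
        a , b , y∷Ps⊆ab , pencil≢0 =
          ∃-pencil-through (y ∷ Ps) (subst (λ l → 3 + l ≤ _) (sym |Ps|≡t) 3+t≤k)
        t≤|abh| = subst (_≤ countOn (a ∷ b ∷ h ∷ []) xs) |Ps|≡t
                    (length≤countOn Ps⊆xs (All.zipWith (uncurry ++⁺) (All.tail y∷Ps⊆ab , Ps⊆h)))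
        [1+q]B<∑ = ℕ.<-≤-trans [1+q]B<|h|+qt (ℕ.≤-trans (ℕ.+-monoʳ-≤ _ (ℕ.*-monoʳ-≤ q t≤|abh|))
                     (ℕ.≤-reflexive (sym (∑-countOn-pencil a b (h ∷ []) xs))))
        i , B<|wh| = pigeonhole (λ i → countOn (pencil a b i ∷ h ∷ []) xs) B [1+q]B<∑
    in pencil a b i , pencil≢0 i , pencil-⊥ (All.head y∷Ps⊆ab) i ,
       subst (B <_) (countOn-swap (pencil a b i) h [] xs) B<|wh|

  pencil-count-bound : ∀ {k m} (xs : List (Vec F k)) (h w y : Vec F k) →
                       (∀ u → NonZeroVec F u → countOn (u ∷ []) xs ≤ m) →
                       h · y ≢ 0F → w ⊥ y → NonZeroVec F w →
                       length xs + q * countOn (h ∷ w ∷ []) xs ≤ suc q * m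
  pencil-count-bound {m = m} xs h w y max h·y≢0 w⊥y w≢0 = begin
    length xs + q * countOn (h ∷ w ∷ []) xs
      ≡⟨ cong (_+ q * countOn (h ∷ w ∷ []) xs) (sym (countOn-[] xs)) ⟩
    countOn [] xs + q * countOn (h ∷ w ∷ []) xs
      ≡⟨ sym (∑-countOn-pencil h w [] xs) ⟩
    ∑[ i < suc q ] countOn (pencil h w i ∷ []) xs
      ≤⟨ ∑-mono-≤ (λ i → max _ (pencil-nonzero h w y h·y≢0 w⊥y w≢0 i)) ⟩
    ∑[ i < suc q ] m
      ≡⟨ ∑-const (suc q) m ⟩
    suc q * m
      ∎
    where open ℕ.≤-Reasoning

  asMDS-length-bound : ∀ {α s t n} (G : Fin n → Vec F (3 + t)) → IsAsMDS F s (3 + t) n G →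
                       α * (q + 1) ≤ s + 1 → n ≤ (s + 1 ∸ α) * (q + 1) + suc t + α
  asMDS-length-bound {α} {s} {t} {n} G (_ , m , ((h , h≢0 , |h|≡m) , max) , m≤n , defect) α[q+1]≤s+1 =
    let y , h·y≢0 = nonzero⇒non-orthogonal h h≢0
        w , w≢0 , w⊥y , t+α<|hw| = ∃-rich-section xs h y ℕ.≤-refl t≤|h| (t + α) [1+q][t+α]<|h|+qt
    in n+q[1+t+α]≤[1+q][2+t+s]⇒n≤bound {α} {q} {s} {t} n α[q+1]≤s+1 (begin
      n + q * suc (t + α)
        ≤⟨ ℕ.+-monoʳ-≤ n (ℕ.*-monoʳ-≤ q t+α<|hw|) ⟩
      n + q * countOn (h ∷ w ∷ []) xs
        ≡⟨ cong (_+ q * countOn (h ∷ w ∷ []) xs) (sym (length-tabulate G)) ⟩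
      length xs + q * countOn (h ∷ w ∷ []) xs
        ≤⟨ pencil-count-bound xs h w y max-countOn h·y≢0 w⊥y w≢0 ⟩
      suc q * m
        ≡⟨ cong (suc q *_) m≡2+t+s ⟩
      suc q * (2 + t + s)
        ∎)
    where
      open ℕ.≤-Reasoning
      xs = tabulate G
      m≡2+t+s = singletonDefect⇒maxCount {t = t} {s} m≤n defect
      |h|≡2+t+s : countOn (h ∷ []) xs ≡ 2 + t + s
      |h|≡2+t+s = trans (sym (hypCount≡countOn h G)) (trans |h|≡m m≡2+t+s)
      max-countOn : ∀ u → NonZeroVec F u → countOn (u ∷ []) xs ≤ m
      max-countOn u u≢0 = subst (_≤ m) (hypCount≡countOn u G) (max u u≢0)
      t≤|h| : t ≤ countOn (h ∷ []) xs
      t≤|h| = subst (t ≤_) (sym |h|≡2+t+s) (ℕ.≤-trans (ℕ.m≤m+n t s) (ℕ.m≤n+m (t + s) 2))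
      [1+q][t+α]<|h|+qt : suc q * (t + α) < countOn (h ∷ []) xs + q * t
      [1+q][t+α]<|h|+qt = subst (λ c → suc q * (t + α) < c + q * t) (sym |h|≡2+t+s)
                            ([1+q][t+α]<[2+t+s]+q*t t α[q+1]≤s+1)

mainTheorem10 : (q : ℕ) (F : FiniteField q) (α s k n : ℕ)
    (G : Fin n → Vec F k) → 3 ≤ k → IsAsMDS F s k n G →
    (α * (q + 1) ≤ s + 1 → n ≤ (s + 1 ∸ α) * (q + 1) + (k ∸ 2) + α)
    × (q ≤ s → n ≤ s * (q + 1) + k ∸ 1)
mainTheorem10 q F α s (suc (suc (suc t))) n G (s≤s (s≤s (s≤s _))) isAsMDS =
  asMDS-length-bound F {α} G isAsMDS ,
  λ q≤s → ℕ.≤-trans (asMDS-length-bound F {1} G isAsMDS (1*[q+1]≤s+1 q≤s)) (ℕ.≤-reflexive bound-at-1)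
  where
    open ≡-Reasoning
    1*[q+1]≤s+1 : q ≤ s → 1 * (q + 1) ≤ s + 1
    1*[q+1]≤s+1 q≤s = subst (_≤ s + 1) (sym (ℕ.*-identityˡ (q + 1))) (ℕ.+-monoˡ-≤ 1 q≤s)
    bound-at-1 : (s + 1 ∸ 1) * (q + 1) + suc t + 1 ≡ s * (q + 1) + suc (suc (suc t)) ∸ 1
    bound-at-1 = begin
      (s + 1 ∸ 1) * (q + 1) + suc t + 1     ≡⟨ cong (λ r → r * (q + 1) + suc t + 1) (ℕ.m+n∸n≡m s 1) ⟩
      s * (q + 1) + suc t + 1               ≡⟨ ℕ.+-assoc (s * (q + 1)) (suc t) 1 ⟩
      s * (q + 1) + (suc t + 1)             ≡⟨ cong (s * (q + 1) +_) (ℕ.+-comm (suc t) 1) ⟩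
      s * (q + 1) + suc (suc t)             ≡⟨ cong (_∸ 1) (sym (ℕ.+-suc (s * (q + 1)) (suc (suc t)))) ⟩
      s * (q + 1) + suc (suc (suc t)) ∸ 1   ∎
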